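{- Let $G$ be a connected graph of order $n\ge 2$, let $H$ be a connected non-bipartite graph of order $n'$, and let $v\in V(H)$. Then: (i) $n\le\dim_l(G\circ_v H)\le n(n'-2)$; (ii) $\dim_l(G\circ_v H)=n$ if and only if $\dim_l(H)=2$ and $v$ belongs to a local metric basis of $H$; (iii) $\dim_l(G\circ_v H)=n(n'-2)$ if and only if $H\cong K_{n'}$; (iv) if $H\not\cong K_{n'}$, then $\dim_l(G\circ_v H)\le n(n'-3)$.
   Context: $G\circ_v H$ denotes the rooted product graph obtained from $G$ (with vertices $u_1,\dots,u_n$) and $n$ disjoint copies of $H$ by identifying the copy of $v$ in the $i$-th copy with $u_i$, for each $i$. For a connected graph $G$, a set $W\subseteq V(G)$ is a local metric generator if for every pair of adjacent vertices $x,y$ there is $w\in W$ with $d_G(x,w)\neq d_G(y,w)$ ($d_G$ the shortest-path distance); $\dim_l(G)$ is the minimum cardinality of a local metric generator, and a local metric generator of this cardinality is a local metric basis. -}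

module Defs where

open import Data.Nat using (ℕ; zero; suc; _≤_; _<_)
open import Data.Bool using (Bool; true; false; _∧_; _∨_; not)
open import Data.Fin using (Fin; remQuot)
open import Data.Fin.Properties using () renaming (_≟_ to _≟ᶠ_)
open import Data.Fin.Subset using (Subset; _∈_; ∣_∣)
open import Data.Product using (Σ; _×_; _,_; ∃)
open import Relation.Binary.PropositionalEquality using (_≡_; _≢_)
open import Relation.Nullary.Decidable using (⌊_⌋)
open import Relation.Nullary using (¬_)
open import Function.Bundles using (_↔_; Inverse)

record Graph (n : ℕ) : Set where
  constructor mkGraph
  field
    Adj : Fin n → Fin n → Bool

open Graph public

_~[_]_ : ∀ {n} → Fin n → Graph n → Fin n → Set
x ~[ G ] y = Adj G x y ≡ true

record IsSimple {n : ℕ} (G : Graph n) : Set where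
  field
    sym     : ∀ x y → Adj G x y ≡ Adj G y x
    irrefl  : ∀ x → Adj G x x ≡ false

data Walk {n : ℕ} (G : Graph n) : ℕ → Fin n → Fin n → Set where
  nil  : ∀ x → Walk G zero x x
  cons : ∀ {k x y z} → x ~[ G ] y → Walk G k y z → Walk G (suc k) x z

Connected : ∀ {n} → Graph n → Set
Connected G = ∀ x y → ∃ λ k → Walk G k x y

Dist : ∀ {n} → Graph n → Fin n → Fin n → ℕ → Set
Dist G x y k = Walk G k x y × (∀ m → m < k → ¬ Walk G m x y)

Distinguishes : ∀ {n} → Graph n → Fin n → Fin n → Fin n → Set
Distinguishes G w x y = ∀ a b → Dist G x w a → Dist G y w b → a ≢ b

IsLocalMetricGenerator : ∀ {n} → Graph n → Subset n → Set
IsLocalMetricGenerator G W =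
  ∀ x y → x ~[ G ] y → ∃ λ w → w ∈ W × Distinguishes G w x y

IsLocalMetricDim : ∀ {n} → Graph n → ℕ → Set
IsLocalMetricDim G k =
  (∃ λ W → IsLocalMetricGenerator G W × ∣ W ∣ ≡ k)
  × (∀ W → IsLocalMetricGenerator G W → k ≤ ∣ W ∣)

IsLocalMetricBasis : ∀ {n} → Graph n → Subset n → Set
IsLocalMetricBasis G W =
  IsLocalMetricGenerator G W × IsLocalMetricDim G ∣ W ∣

Bipartite : ∀ {n} → Graph n → Set
Bipartite G = Σ (Fin _ → Bool) λ c → ∀ x y → x ~[ G ] y → c x ≢ c y

Complete : (n : ℕ) → Graph n
Complete n = mkGraph λ x y → not ⌊ x ≟ᶠ y ⌋

_≅_ : ∀ {n m} → Graph n → Graph m → Set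
G ≅ H = Σ (Fin _ ↔ Fin _) λ f →
  ∀ x y → Adj G x y ≡ Adj H (Inverse.to f x) (Inverse.to f y)

-- rooted product G ∘_v H: vertex (i , a) (encoded via remQuot) is the
-- copy of a ∈ V(H) in the i-th copy of H; (i , v) is identified with u_i.
RootedProduct : ∀ {n n'} → Graph n → Graph n' → Fin n' → Graph (n Data.Nat.* n')
RootedProduct {n} {n'} G H v = mkGraph adj
  where
  adj : Fin (n Data.Nat.* n') → Fin (n Data.Nat.* n') → Bool
  adj p q with remQuot n' p | remQuot n' q
  ... | (i , a) | (j , b) =
    (⌊ i ≟ᶠ j ⌋ ∧ Adj H a b) ∨ (⌊ a ≟ᶠ v ⌋ ∧ ⌊ b ≟ᶠ v ⌋ ∧ Adj G i j)

module Submission where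

open import Defs
open import Data.Nat using (ℕ; zero; suc; _+_; _≤_; _<_; _*_; _∸_; z≤n; s≤s; NonZero)
open import Data.Nat.Properties
open import Data.Bool using (Bool; true; false; not; _∧_; _∨_)
open import Data.Bool.Properties using (∨-zeroʳ; ∧-identityʳ; ∧-conicalˡ; ∧-conicalʳ; not-¬)
  renaming (_≟_ to _≟ᵇ_)
open import Data.Fin using (Fin; zero; suc; _↑ˡ_; _↑ʳ_; combine; remQuot)
open import Data.Fin.Properties
  using (any?; remQuot-combine; combine-remQuot; combine-injectiveˡ; combine-injectiveʳ)
  renaming (_≟_ to _≟ᶠ_)
open import Data.Fin.Subset using (Subset; _∈_; ∣_∣)
open import Data.Vec using ([]; _∷_; lookup; tabulate)
open import Data.Vec.Properties using ([]=⇒lookup; lookup⇒[]=; lookup∘tabulate)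
open import Data.Product using (_×_; _,_; ∃; ∃₂; proj₁; proj₂)
open import Data.Sum using (_⊎_; inj₁; inj₂; [_,_])
open import Data.Empty using (⊥; ⊥-elim)
open import Relation.Binary.PropositionalEquality
  using (_≡_; _≢_; refl; sym; trans; cong; cong₂; subst; subst₂; module ≡-Reasoning)
open import Relation.Binary.Definitions using (tri<; tri≈; tri>)
open import Relation.Nullary using (¬_; Dec; yes; no; contradiction)
open import Relation.Nullary.Decidable using (⌊_⌋; _×-dec_; ¬?)
open import Function using (_∘_; id)
open import Function.Bundles using (Inverse; _⇔_; mk⇔)
open import Function.Construct.Identity using (↔-id)
open import Algebra.Properties.CommutativeSemigroup +-commutativeSemigroup using (interchange)

-- Write P = G ∘_v H and (i , a) for the copy of a ∈ V(H) in the i-th copy H_i.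
-- The geometry (module ProductGeometry): H_i is isometric in P, and every walk
-- leaving H_i passes through its root (i , v), so for w ∉ H_i
--     d_P((i , a) , w) = d_H(a , v) + d_P((i , v) , w).
-- Consequently (module Landmarks) an edge of H_i is distinguished by a landmark
-- (i , c) exactly when c distinguishes it in H, and by a landmark outside H_i
-- exactly when v does; in short, by w iff by the "shadow" of w on H_i.
-- Lower bounds: since H is not bipartite, every vertex w of H sees some edge with
-- both ends equidistant (module NonBipartite).  Taking w = v shows that each copy
-- holds a non-root landmark, so n ≤ dim_l(P); if H is complete each copy misses at
-- most one non-root vertex, so n (n' - 2) ≤ dim_l(P); if dim_l(P) = n the single
-- non-root landmark x of a copy makes {v , x} a local metric basis of H.
-- Upper bounds (module Templates): a set T ⊆ V(H) that resolves every edge of H (by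
-- an endpoint, a vertex of T, or v), placed in every copy, is a generator of size
-- n |T|.  Removing v and one vertex, or v and the two ends of a non-edge (or v, a
-- neighbour of v and a non-neighbour), or keeping just x from a basis {v , x},
-- gives templates of size n' - 2, n' - 3 and 1.  The theorem compares these bounds.

fromTrue : ∀ {ℓ} {A : Set ℓ} (d : Dec A) → ⌊ d ⌋ ≡ true → A
fromTrue (yes a) _ = a
fromTrue (no _) ()

toTrue : ∀ {ℓ} {A : Set ℓ} (d : Dec A) → A → ⌊ d ⌋ ≡ true
toTrue (yes _) _ = refl
toTrue (no ¬a) a = ⊥-elim (¬a a)

∨-true : ∀ x y → x ∨ y ≡ true → x ≡ true ⊎ y ≡ true
∨-true true  y _ = inj₁ refl
∨-true false y e = inj₂ e

adj⇒≢ : ∀ {N} {G : Graph N} → IsSimple G → ∀ {x y} → x ~[ G ] y → x ≢ y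
adj⇒≢ s {x} e refl with trans (sym e) (IsSimple.irrefl s x)
... | ()

no-loop : ∀ {N} {G : Graph N} → IsSimple G → ∀ {x} → ¬ (x ~[ G ] x)
no-loop s e = adj⇒≢ s e refl

false⇒≁ : ∀ {N} (G : Graph N) {x y} → Adj G x y ≡ false → ¬ (x ~[ G ] y)
false⇒≁ G xy-false e = contradiction (trans (sym e) xy-false) λ ()

module Walks {N : ℕ} (G : Graph N) where

  _++ʷ_ : ∀ {j k x y z} → Walk G j x y → Walk G k y z → Walk G (j + k) x z
  nil _    ++ʷ q = q
  cons e p ++ʷ q = cons e (p ++ʷ q)

  edgeWalk : ∀ {x y} → x ~[ G ] y → Walk G 1 x y
  edgeWalk e = cons e (nil _)

  walk₀⇒≡ : ∀ {x y} → Walk G 0 x y → x ≡ y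
  walk₀⇒≡ (nil _) = refl

  walk₁⇒adj : ∀ {x y} → Walk G 1 x y → x ~[ G ] y
  walk₁⇒adj (cons e (nil _)) = e

  dist-min : ∀ {x y k m} → Dist G x y k → Walk G m x y → k ≤ m
  dist-min (_ , shortest) w = ≮⇒≥ (λ m<k → shortest _ m<k w)

  dist-unique : ∀ {x y a b} → Dist G x y a → Dist G x y b → a ≡ b
  dist-unique da db = ≤-antisym (dist-min da (proj₁ db)) (dist-min db (proj₁ da))

  mkDist : ∀ {x y k} → Walk G k x y → (∀ {m} → Walk G m x y → k ≤ m) → Dist G x y k
  mkDist w minimal = w , λ m m<k w' → <⇒≱ m<k (minimal w')

  dist-self : ∀ x → Dist G x x 0
  dist-self x = nil x , λ { m () _ }

  dist₀⇒≡ : ∀ {x y} → Dist G x y 0 → x ≡ y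
  dist₀⇒≡ d = walk₀⇒≡ (proj₁ d)

  dist₁ : ∀ {x y} → x ~[ G ] y → x ≢ y → Dist G x y 1
  dist₁ {x} {y} e x≢y = mkDist (edgeWalk e) positive
    where
    positive : ∀ {m} → Walk G m x y → 1 ≤ m
    positive {zero}  w = ⊥-elim (x≢y (walk₀⇒≡ w))
    positive {suc m} _ = s≤s z≤n

  -- Existence of a walk of given length is decidable (the graph is finite) ...
  walk? : ∀ m x y → Dec (Walk G m x y)
  walk? zero x y with x ≟ᶠ y
  ... | yes refl = yes (nil x)
  ... | no x≢y   = no (x≢y ∘ walk₀⇒≡)
  walk? (suc m) x y with any? (λ z → (Adj G x z ≟ᵇ true) ×-dec walk? m z y)
  ... | yes (z , e , w) = yes (cons e w)
  ... | no ¬step        = no λ { (cons {y = z} e w) → ¬step (z , e , w) }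

  -- ... so, given a walk of length m + d and no walk shorter than m, the first
  -- length ≥ m admitting a walk is the distance.
  firstLength : ∀ {x y} m d → (∀ j → j < m → ¬ Walk G j x y) → Walk G (m + d) x y
              → ∃ λ k → Dist G x y k
  firstLength {x} {y} m d shorter w with walk? m x y
  ... | yes w' = m , w' , shorter
  firstLength {x} {y} m zero shorter w | no ¬w =
    ⊥-elim (¬w (subst (λ k → Walk G k x y) (+-identityʳ m) w))
  firstLength {x} {y} m (suc d) shorter w | no ¬w =
    firstLength (suc m) d shorter' (subst (λ k → Walk G k x y) (+-suc m d) w)
    where
    shorter' : ∀ j → j < suc m → ¬ Walk G j x y
    shorter' j j<1+m with m<1+n⇒m<n∨m≡n j<1+m
    ... | inj₁ j<m  = shorter j j<m
    ... | inj₂ refl = ¬w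

  dist-exists : Connected G → ∀ x y → ∃ λ k → Dist G x y k
  dist-exists conn x y = firstLength 0 (proj₁ (conn x y)) (λ _ ()) (proj₂ (conn x y))

  module Undirected (symm : ∀ x y → Adj G x y ≡ Adj G y x) where

    adj-sym : ∀ {x y} → x ~[ G ] y → y ~[ G ] x
    adj-sym {x} {y} e = trans (symm y x) e

    reverseOnto : ∀ {j k x y z} → Walk G j x y → Walk G k x z → Walk G (j + k) y z
    reverseOnto (nil _) acc = acc
    reverseOnto {suc j} {k} {y = y} {z = z} (cons e p) acc =
      subst (λ t → Walk G t y z) (+-suc j k) (reverseOnto p (cons (adj-sym e) acc))

    reverse : ∀ {j x y} → Walk G j x y → Walk G j y x
    reverse {j} {x} {y} p = subst (λ t → Walk G t y x) (+-identityʳ j) (reverseOnto p (nil x))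

    dist-sym : ∀ {x y k} → Dist G x y k → Dist G y x k
    dist-sym d = mkDist (reverse (proj₁ d)) (λ w → dist-min d (reverse w))

  distinguishes-by-dist : ∀ {w x y α β} → Dist G x w α → Dist G y w β → α ≢ β
                        → Distinguishes G w x y
  distinguishes-by-dist da db α≢β α' β' da' db' α'≡β' =
    α≢β (trans (dist-unique da da') (trans α'≡β' (dist-unique db' db)))

  distinguishes-swap : ∀ {w x y} → Distinguishes G w x y → Distinguishes G w y x
  distinguishes-swap D a b da db a≡b = D b a db da (sym a≡b)

  endpointˡ : ∀ {x y} → x ≢ y → Distinguishes G x x y
  endpointˡ {x} {y} x≢y a b da db a≡b =
    x≢y (sym (dist₀⇒≡ (subst (Dist G y x) (trans (sym a≡b) (dist-unique da (dist-self x))) db)))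

  endpointʳ : ∀ {x y} → x ≢ y → Distinguishes G y x y
  endpointʳ x≢y = distinguishes-swap (endpointˡ (x≢y ∘ sym))

  private-neighbour : ∀ {w x y} → x ~[ G ] w → y ≢ w → ¬ (y ~[ G ] w) → Distinguishes G w x y
  private-neighbour {w} {x} {y} e y≢w y≁w a b da db a≡b =
    farther b (subst (_≤ 1) a≡b (dist-min da (edgeWalk e))) db
    where
    farther : ∀ b → b ≤ 1 → Dist G y w b → ⊥
    farther zero          _          d = y≢w (dist₀⇒≡ d)
    farther (suc zero)    _          d = y≁w (walk₁⇒adj (proj₁ d))
    farther (suc (suc b)) (s≤s ()) d

bit : Bool → ℕ
bit true  = 1
bit false = 0

count : ∀ {m} → (Fin m → Bool) → ℕ
count {zero}  f = 0
count {suc m} f = bit (f zero) + count (f ∘ suc)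

count-cong : ∀ {m} {f g : Fin m → Bool} → (∀ x → f x ≡ g x) → count f ≡ count g
count-cong {zero}  _   = refl
count-cong {suc m} f≗g = cong₂ _+_ (cong bit (f≗g zero)) (count-cong (f≗g ∘ suc))

count-mono : ∀ {m} {f g : Fin m → Bool} → (∀ x → f x ≡ true → g x ≡ true) → count f ≤ count g
count-mono {zero}  _   = z≤n
count-mono {suc m} f⊆g = +-mono-≤ (bit-mono (f⊆g zero)) (count-mono (f⊆g ∘ suc))
  where
  bit-mono : ∀ {a b} → (a ≡ true → b ≡ true) → bit a ≤ bit b
  bit-mono {false} _   = z≤n
  bit-mono {true}  a⇒b rewrite a⇒b refl = ≤-refl

count≤size : ∀ {m} (f : Fin m → Bool) → count f ≤ m
count≤size {zero}  f = z≤n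
count≤size {suc m} f with f zero
... | true  = s≤s (count≤size (f ∘ suc))
... | false = m≤n⇒m≤1+n (count≤size (f ∘ suc))

count-not : ∀ {m} (f : Fin m → Bool) → count (not ∘ f) ≡ m ∸ count f
count-not {m} f = sym (trans (cong (_∸ count f) (sym (partition f))) (m+n∸m≡n (count f) _))
  where
  partition : ∀ {m} (f : Fin m → Bool) → count f + count (not ∘ f) ≡ m
  partition {zero}  f = refl
  partition {suc m} f with f zero
  ... | true  = cong suc (partition (f ∘ suc))
  ... | false = trans (+-suc (count (f ∘ suc)) _) (cong suc (partition (f ∘ suc)))

count-∨ : ∀ {m} (f g : Fin m → Bool) → count (λ x → f x ∨ g x) ≤ count f + count g
count-∨ {zero}  f g = z≤n
count-∨ {suc m} f g = begin
  bit (f zero ∨ g zero) + count (λ x → f (suc x) ∨ g (suc x))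
    ≤⟨ +-mono-≤ (bit-∨ (f zero) (g zero)) (count-∨ (f ∘ suc) (g ∘ suc)) ⟩
  (bit (f zero) + bit (g zero)) + (count (f ∘ suc) + count (g ∘ suc))
    ≡⟨ interchange (bit (f zero)) (bit (g zero)) (count (f ∘ suc)) (count (g ∘ suc)) ⟩
  count f + count g ∎
  where
  open ≤-Reasoning
  bit-∨ : ∀ a b → bit (a ∨ b) ≤ bit a + bit b
  bit-∨ true  b = s≤s z≤n
  bit-∨ false b = ≤-refl

remove : ∀ {m} → (Fin m → Bool) → Fin m → Fin m → Bool
remove f x y = f y ∧ not ⌊ y ≟ᶠ x ⌋

count-remove : ∀ {m} (f : Fin m → Bool) x → f x ≡ true → count f ≡ suc (count (remove f x))
count-remove {suc m} f zero fx rewrite fx =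
  cong suc (count-cong λ y → sym (∧-identityʳ (f (suc y))))
count-remove {suc m} f (suc x) fx = begin
  bit (f zero) + count (f ∘ suc)
    ≡⟨ cong (bit (f zero) +_) (count-remove (f ∘ suc) x fx) ⟩
  bit (f zero) + suc (count (remove (f ∘ suc) x))
    ≡⟨ +-suc (bit (f zero)) _ ⟩
  suc (bit (f zero) + count (remove (f ∘ suc) x))
    ≡⟨ cong suc (cong₂ _+_ (cong bit (sym (∧-identityʳ (f zero))))
                           (count-cong λ y → cong (λ t → f (suc y) ∧ not t) (sym (suc-≟ y x)))) ⟩
  suc (count (remove f (suc x))) ∎
  where
  open ≡-Reasoning
  suc-≟ : ∀ {k} (y x : Fin k) → ⌊ suc y ≟ᶠ suc x ⌋ ≡ ⌊ y ≟ᶠ x ⌋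
  suc-≟ y x with y ≟ᶠ x
  ... | yes refl = refl
  ... | no _     = refl

remove-keeps : ∀ {m} (f : Fin m → Bool) {x y} → f y ≡ true → y ≢ x → remove f x y ≡ true
remove-keeps f {x} {y} fy y≢x with y ≟ᶠ x
... | yes y≡x = ⊥-elim (y≢x y≡x)
... | no _ rewrite fy = refl

count≥1 : ∀ {m} (f : Fin m → Bool) x → f x ≡ true → 1 ≤ count f
count≥1 f x fx rewrite count-remove f x fx = s≤s z≤n

count≥2 : ∀ {m} (f : Fin m → Bool) x y → f x ≡ true → f y ≡ true → y ≢ x → 2 ≤ count f
count≥2 f x y fx fy y≢x rewrite count-remove f x fx =
  s≤s (count≥1 (remove f x) y (remove-keeps f fy y≢x))

count≥3 : ∀ {m} (f : Fin m → Bool) x y z → f x ≡ true → f y ≡ true → f z ≡ true →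
          y ≢ x → z ≢ x → z ≢ y → 3 ≤ count f
count≥3 f x y z fx fy fz y≢x z≢x z≢y rewrite count-remove f x fx =
  s≤s (count≥2 (remove f x) y z (remove-keeps f fy y≢x) (remove-keeps f fz z≢x) z≢y)

single : ∀ {m} → Fin m → Fin m → Bool
single x y = ⌊ y ≟ᶠ x ⌋

single-self : ∀ {m} (x : Fin m) → single x x ≡ true
single-self x = toTrue (x ≟ᶠ x) refl

count-single : ∀ {m} (x : Fin m) → count (single x) ≡ 1
count-single x rewrite count-remove (single x) x (single-self x) = cong suc (count-none _ empty)
  where
  count-none : ∀ {m} (f : Fin m → Bool) → (∀ x → f x ≡ false) → count f ≡ 0
  count-none {zero}  f _   = refl
  count-none {suc m} f none rewrite none zero = count-none (f ∘ suc) (none ∘ suc)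
  empty : ∀ y → remove (single x) x y ≡ false
  empty y with y ≟ᶠ x
  ... | yes _ = refl
  ... | no _  = refl

∣W∣≡count : ∀ {m} (W : Subset m) → ∣ W ∣ ≡ count (lookup W)
∣W∣≡count []          = refl
∣W∣≡count (true  ∷ W) = cong suc (∣W∣≡count W)
∣W∣≡count (false ∷ W) = ∣W∣≡count W

∈⇒lookup : ∀ {m} {W : Subset m} {x} → x ∈ W → lookup W x ≡ true
∈⇒lookup = []=⇒lookup

lookup⇒∈ : ∀ {m} {W : Subset m} {x} → lookup W x ≡ true → x ∈ W
lookup⇒∈ {W = W} {x} = lookup⇒[]= x W

∣tabulate∣ : ∀ {m} (f : Fin m → Bool) → ∣ tabulate f ∣ ≡ count f
∣tabulate∣ f = trans (∣W∣≡count (tabulate f)) (count-cong (lookup∘tabulate f))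

∈tabulate : ∀ {m} {f : Fin m → Bool} {x} → f x ≡ true → x ∈ tabulate f
∈tabulate {f = f} {x} fx = lookup⇒∈ (trans (lookup∘tabulate f x) fx)

sumFin : ∀ {n} → (Fin n → ℕ) → ℕ
sumFin {zero}  f = 0
sumFin {suc n} f = f zero + sumFin (f ∘ suc)

sumFin-cong : ∀ {n} {f g : Fin n → ℕ} → (∀ i → f i ≡ g i) → sumFin f ≡ sumFin g
sumFin-cong {zero}  _   = refl
sumFin-cong {suc n} f≗g = cong₂ _+_ (f≗g zero) (sumFin-cong (f≗g ∘ suc))

sumFin-lower : ∀ {n} m (f : Fin n → ℕ) → (∀ i → m ≤ f i) → n * m ≤ sumFin f
sumFin-lower {zero}  m f _  = z≤n
sumFin-lower {suc n} m f lb = +-mono-≤ (lb zero) (sumFin-lower m (f ∘ suc) (lb ∘ suc))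

sumFin-const : ∀ n k → sumFin {n} (λ _ → k) ≡ n * k
sumFin-const zero    k = refl
sumFin-const (suc n) k = cong (k +_) (sumFin-const n k)

sumFin-exceeds : ∀ {n} (f : Fin n → ℕ) j → (∀ i → 1 ≤ f i) → 2 ≤ f j → suc n ≤ sumFin f
sumFin-exceeds {suc n} f zero pos two =
  +-mono-≤ two (subst (_≤ sumFin (f ∘ suc)) (*-identityʳ n) (sumFin-lower 1 (f ∘ suc) (pos ∘ suc)))
sumFin-exceeds {suc n} f (suc j) pos two =
  +-mono-≤ (pos zero) (sumFin-exceeds (f ∘ suc) j (pos ∘ suc) two)

count-combine : ∀ n {n'} (f : Fin (n * n') → Bool) →
  count f ≡ sumFin (λ (i : Fin n) → count (λ a → f (combine i a)))
count-combine zero    f = refl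
count-combine (suc n) {n'} f =
  trans (count-++ n' f) (cong (count (λ a → f (a ↑ˡ (n * n'))) +_) (count-combine n (λ q → f (n' ↑ʳ q))))
  where
  count-++ : ∀ a {b} (f : Fin (a + b) → Bool) →
    count f ≡ count (λ i → f (i ↑ˡ b)) + count (λ j → f (a ↑ʳ j))
  count-++ zero    f = refl
  count-++ (suc a) f =
    trans (cong (bit (f zero) +_) (count-++ a (f ∘ suc))) (sym (+-assoc (bit (f zero)) _ _))

pair : ∀ {m} → Fin m → Fin m → Fin m → Bool
pair x y c = single x c ∨ single y c

pair-∋ˡ : ∀ {m} (x y : Fin m) → pair x y x ≡ true
pair-∋ˡ x y rewrite single-self x = refl

pair-∋ʳ : ∀ {m} (x y : Fin m) → pair x y y ≡ true
pair-∋ʳ x y rewrite single-self y = ∨-zeroʳ _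

pair-∈ : ∀ {m} (x y : Fin m) {c} → pair x y c ≡ true → c ≡ x ⊎ c ≡ y
pair-∈ x y {c} c∈ with ∨-true (single x c) _ c∈
... | inj₁ c≡x = inj₁ (fromTrue (c ≟ᶠ x) c≡x)
... | inj₂ c≡y = inj₂ (fromTrue (c ≟ᶠ y) c≡y)

pair-∌ : ∀ {m} {x y c : Fin m} → c ≢ x → c ≢ y → pair x y c ≡ false
pair-∌ {x = x} {y} {c} c≢x c≢y with c ≟ᶠ x | c ≟ᶠ y
... | no _    | no _    = refl
... | yes c≡x | _       = ⊥-elim (c≢x c≡x)
... | no _    | yes c≡y = ⊥-elim (c≢y c≡y)

count-pair≤2 : ∀ {m} (x y : Fin m) → count (pair x y) ≤ 2
count-pair≤2 x y =
  subst (count (pair x y) ≤_) (cong₂ _+_ (count-single x) (count-single y)) (count-∨ (single x) (single y))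

triple : ∀ {m} → Fin m → Fin m → Fin m → Fin m → Bool
triple x y z c = single x c ∨ pair y z c

triple-∈ : ∀ {m} (x y z : Fin m) {c} → triple x y z c ≡ true → c ≡ x ⊎ c ≡ y ⊎ c ≡ z
triple-∈ x y z {c} c∈ with ∨-true (single x c) _ c∈
... | inj₁ c≡x = inj₁ (fromTrue (c ≟ᶠ x) c≡x)
... | inj₂ c∈yz = inj₂ (pair-∈ y z c∈yz)

triple-∌ : ∀ {m} {x y z c : Fin m} → c ≢ x → c ≢ y → c ≢ z → triple x y z c ≡ false
triple-∌ {x = x} {c = c} c≢x c≢y c≢z with c ≟ᶠ x
... | yes c≡x = ⊥-elim (c≢x c≡x)
... | no _ = pair-∌ c≢y c≢z

count-triple≥3 : ∀ {m} (x y z : Fin m) → y ≢ x → z ≢ x → z ≢ y → 3 ≤ count (triple x y z)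
count-triple≥3 x y z y≢x z≢x z≢y = count≥3 (triple x y z) x y z
  (cong (_∨ pair y z x) (single-self x)) (cong (single x y ∨_) (pair-∋ˡ y z) ∙ ∨-zeroʳ _)
  (cong (single x z ∨_) (pair-∋ʳ y z) ∙ ∨-zeroʳ _) y≢x z≢x z≢y
  where
  _∙_ = trans

count-not≤ : ∀ {m} (f : Fin m → Bool) k → k ≤ count f → count (not ∘ f) ≤ m ∸ k
count-not≤ {m} f k k≤ = subst (_≤ m ∸ k) (sym (count-not f)) (∸-monoʳ-≤ m k≤)

only-two : ∀ {m} (f : Fin m → Bool) → count f ≤ 2 → ∀ {x y} → f x ≡ true → f y ≡ true → y ≢ x
  → ∀ {z} → f z ≡ true → z ≡ x ⊎ z ≡ y
only-two f ≤2 {x} {y} fx fy y≢x {z} fz with z ≟ᶠ x | z ≟ᶠ y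
... | yes z≡x | _       = inj₁ z≡x
... | no _    | yes z≡y = inj₂ z≡y
... | no z≢x  | no z≢y  = ⊥-elim (1+n≰n (≤-trans (count≥3 f x y z fx fy fz y≢x z≢x z≢y) ≤2))

another-member : ∀ {m} (f : Fin m → Bool) → 2 ≤ count f → ∀ x → ∃ λ y → f y ≡ true × y ≢ x
another-member f ≥2 x with any? (λ y → (f y ≟ᵇ true) ×-dec ¬? (y ≟ᶠ x))
... | yes found = found
... | no none = ⊥-elim (1+n≰n (≤-trans ≥2 (subst (count f ≤_) (count-single x) (count-mono ⊆x))))
  where
  ⊆x : ∀ y → f y ≡ true → single x y ≡ true
  ⊆x y fy with y ≟ᶠ x
  ... | yes _   = refl
  ... | no y≢x = ⊥-elim (none (y , fy , y≢x))

parity : ℕ → Bool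
parity zero    = false
parity (suc k) = not (parity k)

neighbouring-distances : ∀ a b → a ≢ b → b ≤ suc a → a ≤ suc b → b ≡ suc a ⊎ a ≡ suc b
neighbouring-distances a b a≢b b≤1+a a≤1+b with <-cmp a b
... | tri< a<b _ _ = inj₁ (≤-antisym b≤1+a a<b)
... | tri≈ _ a≡b _ = ⊥-elim (a≢b a≡b)
... | tri> _ _ b<a = inj₂ (≤-antisym a≤1+b b<a)

module NonBipartite {N : ℕ} (G : Graph N) (symm : ∀ x y → Adj G x y ≡ Adj G y x)
                    (conn : Connected G) where
  open Walks G
  open Undirected symm

  -- For every vertex w some edge has both endpoints at the same distance from w:
  -- otherwise the parity of the distance to w would be a proper 2-colouring.
  equidistantEdge : ¬ Bipartite G → (w : Fin N) →
    ∃₂ λ a b → a ~[ G ] b × ∃ λ s → Dist G a w s × Dist G b w s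
  equidistantEdge nb w
    with any? (λ a → any? (λ b → (Adj G a b ≟ᵇ true) ×-dec (δ a ≟ δ b)))
    where
    δ : Fin N → ℕ
    δ x = proj₁ (dist-exists conn x w)
  ... | yes (a , b , e , δa≡δb) = a , b , e , _ , proj₂ (dist-exists conn a w) ,
          subst (Dist G b w) (sym δa≡δb) (proj₂ (dist-exists conn b w))
  ... | no ¬equidistant = ⊥-elim (nb ((λ x → parity (δ x)) , colouring))
    where
    δ : Fin N → ℕ
    δ x = proj₁ (dist-exists conn x w)
    δ-dist : ∀ x → Dist G x w (δ x)
    δ-dist x = proj₂ (dist-exists conn x w)
    colouring : ∀ a b → a ~[ G ] b → parity (δ a) ≢ parity (δ b)
    colouring a b e
      with neighbouring-distances (δ a) (δ b) (λ eq → ¬equidistant (a , b , e , eq))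
             (dist-min (δ-dist b) (cons (adj-sym e) (proj₁ (δ-dist a))))
             (dist-min (δ-dist a) (cons e (proj₁ (δ-dist b))))
    ... | inj₁ δb≡1+δa rewrite δb≡1+δa = not-¬ refl
    ... | inj₂ δa≡1+δb rewrite δa≡1+δb = not-¬ refl ∘ sym

  -- A local metric generator has at least two landmarks: whichever landmark w₀
  -- distinguishes some edge, another edge is equidistant from w₀.
  generator≥2 : ¬ Bipartite G → Fin N → ∀ W → IsLocalMetricGenerator G W → 2 ≤ ∣ W ∣
  generator≥2 nb x W gen with equidistantEdge nb x
  ... | a , b , e , _ with gen a b e
  ...   | w₀ , w₀∈W , _ with equidistantEdge nb w₀
  ...     | a' , b' , e' , s , ds , ds' with gen a' b' e'
  ...       | w , w∈W , D with w ≟ᶠ w₀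
  ...         | yes refl = ⊥-elim (D s s ds ds' refl)
  ...         | no w≢w₀ = subst (2 ≤_) (sym (∣W∣≡count W))
                  (count≥2 (lookup W) w₀ w (∈⇒lookup w₀∈W) (∈⇒lookup w∈W) w≢w₀)

-- A simple graph whose vertices all lie in {p, q, r}, with p and q non-adjacent, is
-- bipartite: colour r against the rest.  (Used to show non-bipartite graphs are large.)
threeVertices⇒bipartite : ∀ {N} (G : Graph N) → IsSimple G → ∀ p q r → ¬ (p ~[ G ] q)
  → (∀ x → x ≡ p ⊎ x ≡ q ⊎ x ≡ r) → Bipartite G
threeVertices⇒bipartite G s p q r p≁q cover = (λ x → ⌊ x ≟ᶠ r ⌋) , colouring
  where
  open Walks.Undirected G (IsSimple.sym s)
  colouring : ∀ x y → x ~[ G ] y → ⌊ x ≟ᶠ r ⌋ ≢ ⌊ y ≟ᶠ r ⌋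
  colouring x y e with x ≟ᶠ r | y ≟ᶠ r
  ... | yes refl | yes refl = λ _ → no-loop s e
  ... | yes _    | no _     = λ ()
  ... | no _     | yes _    = λ ()
  ... | no x≢r   | no y≢r with cover x | cover y
  ...   | inj₂ (inj₂ x≡r) | _               = ⊥-elim (x≢r x≡r)
  ...   | _               | inj₂ (inj₂ y≡r) = ⊥-elim (y≢r y≡r)
  ...   | inj₁ refl        | inj₁ refl        = λ _ → no-loop s e
  ...   | inj₂ (inj₁ refl) | inj₂ (inj₁ refl) = λ _ → no-loop s e
  ...   | inj₁ refl        | inj₂ (inj₁ refl) = λ _ → p≁q e
  ...   | inj₂ (inj₁ refl) | inj₁ refl        = λ _ → p≁q (adj-sym e)

vertex-outside : ∀ {N} (G : Graph N) → IsSimple G → ¬ Bipartite G → ∀ p q r → ¬ (p ~[ G ] q)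
  → ∃ λ c → c ≢ p × c ≢ q × c ≢ r
vertex-outside G s nb p q r p≁q with any? (λ c → ¬? (c ≟ᶠ p) ×-dec (¬? (c ≟ᶠ q) ×-dec ¬? (c ≟ᶠ r)))
... | yes (c , c∉) = c , c∉
... | no none = ⊥-elim (nb (threeVertices⇒bipartite G s p q r p≁q cover))
  where
  cover : ∀ x → x ≡ p ⊎ x ≡ q ⊎ x ≡ r
  cover x with x ≟ᶠ p | x ≟ᶠ q | x ≟ᶠ r
  ... | yes x≡p | _       | _       = inj₁ x≡p
  ... | no _    | yes x≡q | _       = inj₂ (inj₁ x≡q)
  ... | no _    | no _    | yes x≡r = inj₂ (inj₂ x≡r)
  ... | no x≢p  | no x≢q  | no x≢r  = ⊥-elim (none (x , x≢p , x≢q , x≢r))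

nonBipartite⇒order≥3 : ∀ {N} (G : Graph N) → IsSimple G → ¬ Bipartite G → Fin N → 3 ≤ N
nonBipartite⇒order≥3 G s nb x with vertex-outside G s nb x x x (no-loop s)
... | y , y≢x , _ with vertex-outside G s nb x x y (no-loop s)
...   | z , z≢x , _ , z≢y = ≤-trans (count≥3 (λ _ → true) x y z refl refl refl y≢x z≢x z≢y) (count≤size _)

≅Complete⇒adjacent : ∀ {m} {H : Graph m} → H ≅ Complete m → ∀ a b → a ≢ b → a ~[ H ] b
≅Complete⇒adjacent (f , preserves) a b a≢b with Inverse.to f a ≟ᶠ Inverse.to f b in eq
... | no _ = trans (preserves a b) (cong (λ d → not ⌊ d ⌋) eq)
... | yes fa≡fb = ⊥-elim (a≢b (trans (sym (Inverse.strictlyInverseʳ f a))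
                     (trans (cong (Inverse.from f) fa≡fb) (Inverse.strictlyInverseʳ f b))))

complete-or-nonedge : ∀ {m} (H : Graph m) → IsSimple H →
  (H ≅ Complete m) ⊎ (∃₂ λ x y → x ≢ y × Adj H x y ≡ false)
complete-or-nonedge {m} H s with any? (λ x → any? (λ y → ¬? (x ≟ᶠ y) ×-dec (Adj H x y ≟ᵇ false)))
... | yes nonedge = inj₂ nonedge
... | no ¬nonedge = inj₁ (↔-id (Fin m) , same)
  where
  same : ∀ x y → Adj H x y ≡ Adj (Complete m) x y
  same x y with x ≟ᶠ y
  ... | yes refl = IsSimple.irrefl s x
  ... | no x≢y with Adj H x y in eq
  ...   | true  = refl
  ...   | false = ⊥-elim (¬nonedge (x , y , x≢y , eq))

-- In a graph where distinct vertices are adjacent, only a and b themselves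
-- distinguish a from b (every other vertex is at distance one from both).
complete-distinguishes : ∀ {m} (H : Graph m) → (∀ a b → a ≢ b → a ~[ H ] b) →
  ∀ {a b c} → Distinguishes H c a b → c ≡ a ⊎ c ≡ b
complete-distinguishes H adjacent {a} {b} {c} D with c ≟ᶠ a | c ≟ᶠ b
... | yes c≡a | _       = inj₁ c≡a
... | no _    | yes c≡b = inj₂ c≡b
... | no c≢a  | no c≢b  =
  ⊥-elim (D 1 1 (dist₁ (adjacent a c (c≢a ∘ sym)) (c≢a ∘ sym)) (dist₁ (adjacent b c (c≢b ∘ sym)) (c≢b ∘ sym)) refl)
  where open Walks H

n[n'∸2]≰n[n'∸3] : ∀ n n' .{{_ : NonZero n}} → 3 ≤ n' → ¬ (n * (n' ∸ 2) ≤ n * (n' ∸ 3))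
n[n'∸2]≰n[n'∸3] n (suc (suc (suc m))) _ le = 1+n≰n (*-cancelˡ-≤ n le)
n[n'∸2]≰n[n'∸3] n (suc (suc zero)) (s≤s (s≤s ()))
n[n'∸2]≰n[n'∸3] n (suc zero) (s≤s ())

module ProductGeometry {n n' : ℕ} (G : Graph n) (H : Graph n') (v : Fin n')
         (symG : ∀ x y → Adj G x y ≡ Adj G y x) (symH : ∀ x y → Adj H x y ≡ Adj H y x) where

  P : Graph (n * n')
  P = RootedProduct G H v

  vertex : Fin n → Fin n' → Fin (n * n')
  vertex = combine

  copyIndex : Fin (n * n') → Fin n
  copyIndex p = proj₁ (remQuot {n} n' p)

  base : Fin (n * n') → Fin n'
  base p = proj₂ (remQuot {n} n' p)

  vertex-η : ∀ p → vertex (copyIndex p) (base p) ≡ p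
  vertex-η p = combine-remQuot {n} n' p

  copyIndex-vertex : ∀ i a → copyIndex (vertex i a) ≡ i
  copyIndex-vertex i a = cong proj₁ (remQuot-combine i a)

  base-vertex : ∀ i a → base (vertex i a) ≡ a
  base-vertex i a = cong proj₂ (remQuot-combine i a)

  vertex-≡ : ∀ {w i c} → copyIndex w ≡ i → base w ≡ c → w ≡ vertex i c
  vertex-≡ {w} refl refl = sym (vertex-η w)

  adjacency : Fin n × Fin n' → Fin n × Fin n' → Bool
  adjacency (i , a) (j , b) = (⌊ i ≟ᶠ j ⌋ ∧ Adj H a b) ∨ (⌊ a ≟ᶠ v ⌋ ∧ ⌊ b ≟ᶠ v ⌋ ∧ Adj G i j)

  Adj-P : ∀ p q → Adj P p q ≡ adjacency (remQuot {n} n' p) (remQuot {n} n' q)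
  Adj-P p q with remQuot {n} n' p | remQuot {n} n' q
  ... | (i , a) | (j , b) = refl

  Adj-vertex : ∀ i a j b → Adj P (vertex i a) (vertex j b) ≡ adjacency (i , a) (j , b)
  Adj-vertex i a j b =
    trans (Adj-P (vertex i a) (vertex j b)) (cong₂ adjacency (remQuot-combine i a) (remQuot-combine j b))

  adjacency-cases : ∀ i a j b → adjacency (i , a) (j , b) ≡ true →
    (i ≡ j × a ~[ H ] b) ⊎ (a ≡ v × b ≡ v × i ~[ G ] j)
  adjacency-cases i a j b e with ∨-true (⌊ i ≟ᶠ j ⌋ ∧ Adj H a b) _ e
  ... | inj₁ inCopy =
    inj₁ (fromTrue (i ≟ᶠ j) (∧-conicalˡ _ _ inCopy) , ∧-conicalʳ ⌊ i ≟ᶠ j ⌋ _ inCopy)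
  ... | inj₂ rootEdge =
    let roots = ∧-conicalʳ ⌊ a ≟ᶠ v ⌋ _ rootEdge in
    inj₂ (fromTrue (a ≟ᶠ v) (∧-conicalˡ _ _ rootEdge) , fromTrue (b ≟ᶠ v) (∧-conicalˡ _ _ roots) ,
          ∧-conicalʳ ⌊ b ≟ᶠ v ⌋ _ roots)

  edge-cases : ∀ {p q} → p ~[ P ] q →
    (copyIndex p ≡ copyIndex q × base p ~[ H ] base q) ⊎ (base p ≡ v × base q ≡ v × copyIndex p ~[ G ] copyIndex q)
  edge-cases {p} {q} e = adjacency-cases _ _ _ _ (trans (sym (Adj-P p q)) e)

  copy-edge : ∀ i {a b} → a ~[ H ] b → vertex i a ~[ P ] vertex i b
  copy-edge i {a} {b} e rewrite Adj-vertex i a i b | toTrue (i ≟ᶠ i) refl | e = refl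

  root-edge : ∀ {i j} → i ~[ G ] j → vertex i v ~[ P ] vertex j v
  root-edge {i} {j} e rewrite Adj-vertex i v j v | toTrue (v ≟ᶠ v) refl | e = ∨-zeroʳ _

  symP : ∀ p q → Adj P p q ≡ Adj P q p
  symP p q = trans (Adj-P p q) (trans (adjacency-sym (remQuot {n} n' p) (remQuot {n} n' q)) (sym (Adj-P q p)))
    where
    ≟-sym : ∀ {k} (i j : Fin k) → ⌊ i ≟ᶠ j ⌋ ≡ ⌊ j ≟ᶠ i ⌋
    ≟-sym i j with i ≟ᶠ j | j ≟ᶠ i
    ... | yes _   | yes _   = refl
    ... | no _    | no _    = refl
    ... | yes i≡j | no j≢i = ⊥-elim (j≢i (sym i≡j))
    ... | no i≢j  | yes j≡i = ⊥-elim (i≢j (sym j≡i))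
    ∧-swap : ∀ x y z → x ∧ (y ∧ z) ≡ y ∧ (x ∧ z)
    ∧-swap true  y     z = refl
    ∧-swap false true  z = refl
    ∧-swap false false z = refl
    adjacency-sym : ∀ x y → adjacency x y ≡ adjacency y x
    adjacency-sym (i , a) (j , b) = cong₂ _∨_ (cong₂ _∧_ (≟-sym i j) (symH a b))
      (trans (∧-swap ⌊ a ≟ᶠ v ⌋ ⌊ b ≟ᶠ v ⌋ (Adj G i j))
             (cong (λ t → ⌊ b ≟ᶠ v ⌋ ∧ (⌊ a ≟ᶠ v ⌋ ∧ t)) (symG i j)))

  open Walks P public renaming (_++ʷ_ to _++ᴾ_)
  module WalksH = Walks H

  walkP-cong : ∀ {m p p' q q'} → p ≡ p' → q ≡ q' → Walk P m p q → Walk P m p' q'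
  walkP-cong refl refl w = w

  walkH-cong : ∀ {m a a' b b'} → a ≡ a' → b ≡ b' → Walk H m a b → Walk H m a' b'
  walkH-cong refl refl w = w

  liftH : ∀ i {m a b} → Walk H m a b → Walk P m (vertex i a) (vertex i b)
  liftH i (nil a)    = nil (vertex i a)
  liftH i (cons e w) = cons (copy-edge i e) (liftH i w)

  liftG : ∀ {m i j} → Walk G m i j → Walk P m (vertex i v) (vertex j v)
  liftG (nil i)    = nil (vertex i v)
  liftG (cons e w) = cons (root-edge e) (liftG w)

  connectedP : Connected G → Connected H → Connected P
  connectedP cG cH p q =
    let (_ , toRoot)   = cH (base p) v
        (_ , alongG)   = cG (copyIndex p) (copyIndex q)
        (_ , fromRoot) = cH v (base q)
    in _ , walkP-cong (vertex-η p) (vertex-η q)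
             (liftH (copyIndex p) toRoot ++ᴾ (liftG alongG ++ᴾ liftH (copyIndex q) fromRoot))

  -- The retraction of P onto H_i: vertices outside H_i collapse to the root.
  shadow : Fin n → Fin (n * n') → Fin n'
  shadow i p with copyIndex p ≟ᶠ i
  ... | yes _ = base p
  ... | no _  = v

  shadow-in : ∀ {i p} → copyIndex p ≡ i → shadow i p ≡ base p
  shadow-in {i} {p} p∈Hᵢ with copyIndex p ≟ᶠ i
  ... | yes _ = refl
  ... | no p∉Hᵢ = ⊥-elim (p∉Hᵢ p∈Hᵢ)

  shadow-out : ∀ {i p} → copyIndex p ≢ i → shadow i p ≡ v
  shadow-out {i} {p} p∉Hᵢ with copyIndex p ≟ᶠ i
  ... | yes p∈Hᵢ = ⊥-elim (p∉Hᵢ p∈Hᵢ)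
  ... | no _     = refl

  shadow-root : ∀ {i p} → base p ≡ v → shadow i p ≡ v
  shadow-root {i} {p} isRoot with copyIndex p ≟ᶠ i
  ... | yes _ = isRoot
  ... | no _  = refl

  shadow-vertex : ∀ i a → shadow i (vertex i a) ≡ a
  shadow-vertex i a = trans (shadow-in (copyIndex-vertex i a)) (base-vertex i a)

  shadow-walk : ∀ i {k p q} → Walk P k p q → ∃ λ m → m ≤ k × Walk H m (shadow i p) (shadow i q)
  shadow-walk i (nil p) = 0 , z≤n , nil (shadow i p)
  shadow-walk i {suc k} {p} (cons e w) with shadow-walk i w | edge-cases e
  ... | m , m≤k , w' | inj₂ (p-root , p'-root , _) =
    m , m≤n⇒m≤1+n m≤k , walkH-cong (trans (shadow-root p'-root) (sym (shadow-root p-root))) refl w'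
  ... | m , m≤k , w' | inj₁ (sameCopy , eH) = step (copyIndex p ≟ᶠ i)
    where
    step : Dec (copyIndex p ≡ i) → ∃ λ m → m ≤ suc k × Walk H m (shadow i p) (shadow i _)
    step (yes p∈Hᵢ) = suc m , s≤s m≤k ,
      cons (subst₂ (λ x y → x ~[ H ] y) (sym (shadow-in p∈Hᵢ))
                   (sym (shadow-in (trans (sym sameCopy) p∈Hᵢ))) eH) w'
    step (no p∉Hᵢ) = m , m≤n⇒m≤1+n m≤k ,
      walkH-cong (trans (shadow-out (p∉Hᵢ ∘ trans sameCopy)) (sym (shadow-out p∉Hᵢ))) refl w'

  dist-copy : ∀ i {a b s} → Dist H a b s → Dist P (vertex i a) (vertex i b) s
  dist-copy i {a} {b} d = mkDist (liftH i (proj₁ d)) λ w →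
    let (m , m≤k , w') = shadow-walk i w
    in ≤-trans (WalksH.dist-min d (walkH-cong (shadow-vertex i a) (shadow-vertex i b) w')) m≤k

  throughRoot : ∀ i {k p q} → Walk P k p q → copyIndex p ≡ i → copyIndex q ≢ i →
    ∃₂ λ k₁ k₂ → k ≡ k₁ + k₂ × Walk P k₁ p (vertex i v) × Walk P k₂ (vertex i v) q
  throughRoot i (nil p) p∈Hᵢ q∉Hᵢ = ⊥-elim (q∉Hᵢ p∈Hᵢ)
  throughRoot i {suc k} {p} (cons e w) p∈Hᵢ q∉Hᵢ with edge-cases e
  ... | inj₂ (p-root , _ , _) = 0 , suc k , refl , walkP-cong refl root (nil p) , walkP-cong root refl (cons e w)
    where
    root : p ≡ vertex i v
    root = vertex-≡ p∈Hᵢ p-root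
  ... | inj₁ (sameCopy , _) with throughRoot i w (trans (sym sameCopy) p∈Hᵢ) q∉Hᵢ
  ...   | k₁ , k₂ , k≡ , w₁ , w₂ = suc k₁ , k₂ , cong suc k≡ , cons e w₁ , w₂

  dist-through-root : ∀ i {a s t q} → Dist H a v s → Dist P (vertex i v) q t → copyIndex q ≢ i
    → Dist P (vertex i a) q (s + t)
  dist-through-root i {a} {s} {t} dH dP q∉Hᵢ = mkDist (liftH i (proj₁ dH) ++ᴾ proj₁ dP) λ w →
    let (k₁ , k₂ , k≡ , w₁ , w₂) = throughRoot i w (copyIndex-vertex i a) q∉Hᵢ
    in subst (s + t ≤_) (sym k≡) (+-mono-≤ (dist-min (dist-copy i dH) w₁) (dist-min dP w₂))

GeneratorWithin : ∀ {N} → Graph N → ℕ → Set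
GeneratorWithin P k = ∃ λ W → IsLocalMetricGenerator P W × ∣ W ∣ ≤ k

module Landmarks {n n' : ℕ} (G : Graph n) (H : Graph n') (v : Fin n')
         (sG : IsSimple G) (cG : Connected G) (sH : IsSimple H) (cH : Connected H) where

  open ProductGeometry G H v (IsSimple.sym sG) (IsSimple.sym sH) public
  open NonBipartite H (IsSimple.sym sH) cH using (equidistantEdge; generator≥2)
  open Undirected symP using () renaming (dist-sym to dist-symP)
  open WalksH.Undirected (IsSimple.sym sH) using () renaming (adj-sym to adj-symH; dist-sym to dist-symH)

  distP : ∀ p q → ∃ λ k → Dist P p q k
  distP = dist-exists (connectedP cG cH)

  distH : ∀ a b → ∃ λ k → Dist H a b k
  distH = WalksH.dist-exists cH

  landmark-inside : ∀ {i a b c} → Distinguishes H c a b → Distinguishes P (vertex i c) (vertex i a) (vertex i b)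
  landmark-inside {i} {a} {b} {c} D with distH a c | distH b c
  ... | s , ds | s' , ds' = distinguishes-by-dist (dist-copy i ds) (dist-copy i ds') (D s s' ds ds')

  landmark-outside : ∀ {i a b w} → copyIndex w ≢ i → Distinguishes H v a b
    → Distinguishes P w (vertex i a) (vertex i b)
  landmark-outside {i} {a} {b} {w} w∉Hᵢ D with distH a v | distH b v | distP (vertex i v) w
  ... | s , ds | s' , ds' | t , dt =
    distinguishes-by-dist (dist-through-root i ds dt w∉Hᵢ) (dist-through-root i ds' dt w∉Hᵢ)
      (λ eq → D s s' ds ds' (+-cancelʳ-≡ t s s' eq))

  shadow-distinguishes : ∀ {i a b w} → Distinguishes P w (vertex i a) (vertex i b)
    → Distinguishes H (shadow i w) a b
  shadow-distinguishes {i} {a} {b} {w} D s s' ds ds' s≡s' with copyIndex w ≟ᶠ i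
  ... | yes w∈Hᵢ = D s s' (onW (dist-copy i ds)) (onW (dist-copy i ds')) s≡s'
    where
    onW : ∀ {x k} → Dist P x (vertex i (base w)) k → Dist P x w k
    onW {x} {k} = subst (λ y → Dist P x y k) (sym (vertex-≡ w∈Hᵢ refl))
  ... | no w∉Hᵢ = let (t , dt) = distP (vertex i v) w in
    D (s + t) (s' + t) (dist-through-root i ds dt w∉Hᵢ) (dist-through-root i ds' dt w∉Hᵢ) (cong (_+ t) s≡s')

  shadow-nonroot : ∀ {i w} → shadow i w ≢ v → w ≡ vertex i (shadow i w)
  shadow-nonroot {i} {w} nonroot with copyIndex w ≟ᶠ i
  ... | yes w∈Hᵢ = vertex-≡ w∈Hᵢ refl
  ... | no _     = ⊥-elim (nonroot refl)

  block : Subset (n * n') → Fin n → Fin n' → Bool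
  block W i a = lookup W (vertex i a)

  shadow-in-block : ∀ W {i w c} → shadow i w ≡ c → c ≢ v → w ∈ W → block W i c ≡ true
  shadow-in-block W refl c≢v w∈W = ∈⇒lookup (subst (_∈ W) (shadow-nonroot c≢v) w∈W)

  ∣W∣≡Σblock : ∀ W → ∣ W ∣ ≡ sumFin (λ i → count (block W i))
  ∣W∣≡Σblock W = trans (∣W∣≡count W) (count-combine n (lookup W))

  -- Lower bound: every copy contains a non-root landmark.  Take an edge ab of H
  -- equidistant from v (H is non-bipartite); only a landmark of H_i - (i , v) can
  -- distinguish its copy in H_i.
  nonroot-landmark : ¬ Bipartite H → ∀ W → IsLocalMetricGenerator P W → ∀ i
    → ∃ λ c → c ≢ v × block W i c ≡ true
  nonroot-landmark nb W gen i with equidistantEdge nb v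
  ... | a , b , e , s , ds , ds' with gen (vertex i a) (vertex i b) (copy-edge i e)
  ...   | w , w∈W , D = shadow i w , c≢v , shadow-in-block W refl c≢v w∈W
    where
    c≢v : shadow i w ≢ v
    c≢v c≡v = shadow-distinguishes D s s (subst (λ y → Dist H a y s) (sym c≡v) ds)
                                           (subst (λ y → Dist H b y s) (sym c≡v) ds') refl

  block-nonempty : ¬ Bipartite H → ∀ W → IsLocalMetricGenerator P W → ∀ i → 1 ≤ count (block W i)
  block-nonempty nb W gen i = let (c , _ , c∈) = nonroot-landmark nb W gen i in count≥1 (block W i) c c∈

  n≤∣generator∣ : ¬ Bipartite H → ∀ W → IsLocalMetricGenerator P W → n ≤ ∣ W ∣
  n≤∣generator∣ nb W gen =
    subst₂ _≤_ (*-identityʳ n) (sym (∣W∣≡Σblock W)) (sumFin-lower 1 _ (block-nonempty nb W gen))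

  block-cofinite : ∀ W i a → (∀ b → b ≢ v → b ≢ a → block W i b ≡ true) → n' ∸ 2 ≤ count (block W i)
  block-cofinite W i a present = ≤-trans (∸-monoʳ-≤ n' (count-pair≤2 v a))
    (subst (_≤ count (block W i)) (count-not (pair v a)) (count-mono covered))
    where
    covered : ∀ b → not (pair v a b) ≡ true → block W i b ≡ true
    covered b b∉ with b ≟ᶠ v | b ≟ᶠ a
    ... | no b≢v | no b≢a = present b b≢v b≢a
    ... | yes _  | _      = contradiction b∉ λ ()
    ... | no _   | yes _  = contradiction b∉ λ ()

  -- If
  -- non-root a and b were both missing from block i, the edge between their copies
  -- could only be distinguished by (i , a) or (i , b), which are not landmarks.
  complete-block : H ≅ Complete n' → ∀ W → IsLocalMetricGenerator P W → ∀ i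
    → n' ∸ 2 ≤ count (block W i)
  complete-block K W gen i with any? (λ a → ¬? (a ≟ᶠ v) ×-dec (block W i a ≟ᵇ false))
  ... | no none = block-cofinite W i v λ b b≢v _ → present b b≢v
    where
    present : ∀ b → b ≢ v → block W i b ≡ true
    present b b≢v with block W i b in eq
    ... | true  = refl
    ... | false = ⊥-elim (none (b , b≢v , eq))
  ... | yes (a , a≢v , a∉) = block-cofinite W i a present
    where
    adjacent : ∀ a b → a ≢ b → a ~[ H ] b
    adjacent = ≅Complete⇒adjacent K
    present : ∀ b → b ≢ v → b ≢ a → block W i b ≡ true
    present b b≢v b≢a with block W i b in b∉
    ... | true = refl
    ... | false with gen (vertex i a) (vertex i b) (copy-edge i (adjacent a b (b≢a ∘ sym)))
    ...   | w , w∈W , D with complete-distinguishes H adjacent (shadow-distinguishes D)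
    ...     | inj₁ c≡a = contradiction (trans (sym a∉) (shadow-in-block W c≡a a≢v w∈W)) λ ()
    ...     | inj₂ c≡b = contradiction (trans (sym b∉) (shadow-in-block W c≡b b≢v w∈W)) λ ()

  complete⇒n[n'∸2]≤∣generator∣ : H ≅ Complete n' → ∀ W → IsLocalMetricGenerator P W → n * (n' ∸ 2) ≤ ∣ W ∣
  complete⇒n[n'∸2]≤∣generator∣ K W gen =
    subst (n * (n' ∸ 2) ≤_) (sym (∣W∣≡Σblock W)) (sumFin-lower (n' ∸ 2) _ (complete-block K W gen))

  -- (ii), forward: if some generator has exactly n landmarks, every block holds
  -- exactly one non-root landmark; for a block i₀ with landmark x, {v , x} is a local
  -- metric basis of H, since the shadows on H_i₀ of the landmarks all lie in {v , x}.
  size-n⇒basis-through-root : ¬ Bipartite H → Fin n → ∀ W → IsLocalMetricGenerator P W → ∣ W ∣ ≡ n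
    → IsLocalMetricDim H 2 × ∃ λ B → IsLocalMetricBasis H B × v ∈ B
  size-n⇒basis-through-root nb i₀ W gen ∣W∣≡n with nonroot-landmark nb W gen i₀
  ... | x , x≢v , x∈ =
    dim₂ , B , (genB , subst (IsLocalMetricDim H) (sym ∣B∣≡2) dim₂) , ∈tabulate (pair-∋ˡ v x)
    where
    unique : ∀ c → c ≢ v → block W i₀ c ≡ true → c ≡ x
    unique c c≢v c∈ with c ≟ᶠ x
    ... | yes c≡x = c≡x
    ... | no c≢x = ⊥-elim (1+n≰n (subst (suc n ≤_) (trans (sym (∣W∣≡Σblock W)) ∣W∣≡n)
            (sumFin-exceeds _ i₀ (block-nonempty nb W gen) (count≥2 (block W i₀) x c x∈ c∈ c≢x))))
    B : Subset n'
    B = tabulate (pair v x)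
    ∈B : ∀ c → (c ≢ v → block W i₀ c ≡ true) → c ∈ B
    ∈B c c∈ with c ≟ᶠ v
    ... | yes refl = ∈tabulate (pair-∋ˡ v x)
    ... | no c≢v   = ∈tabulate (subst (λ y → pair v x y ≡ true) (sym (unique c c≢v (c∈ c≢v))) (pair-∋ʳ v x))
    genB : IsLocalMetricGenerator H B
    genB a b e with gen (vertex i₀ a) (vertex i₀ b) (copy-edge i₀ e)
    ... | w , w∈W , D = shadow i₀ w , ∈B _ (λ c≢v → shadow-in-block W refl c≢v w∈W) , shadow-distinguishes D
    ∣B∣≡2 : ∣ B ∣ ≡ 2
    ∣B∣≡2 = trans (∣tabulate∣ (pair v x))
      (≤-antisym (count-pair≤2 v x) (count≥2 (pair v x) v x (pair-∋ˡ v x) (pair-∋ʳ v x) x≢v))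
    dim₂ : IsLocalMetricDim H 2
    dim₂ = (B , genB , ∣B∣≡2) , generator≥2 nb v

  -- Upper bounds, for G with at least two vertices (so that every copy H_i has a
  -- copy H_j, j ≠ i, to hold a landmark seeing H_i through its root).
  module Templates (another : ∀ (i : Fin n) → ∃ λ j → j ≢ i) where

    Resolves : (Fin n' → Bool) → Set
    Resolves T = ∀ a b → a ~[ H ] b →
      T a ≡ true ⊎ T b ≡ true ⊎ (∃ λ c → T c ≡ true × Distinguishes H c a b) ⊎ Distinguishes H v a b

    spread : (Fin n' → Bool) → Subset (n * n')
    spread T = tabulate (T ∘ base)

    ∈spread : ∀ {T i a} → T a ≡ true → vertex i a ∈ spread T
    ∈spread {T} {i} {a} Ta = ∈tabulate (trans (cong T (base-vertex i a)) Ta)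

    ∣spread∣ : ∀ T → ∣ spread T ∣ ≡ n * count T
    ∣spread∣ T = begin
      ∣ spread T ∣                                          ≡⟨ ∣tabulate∣ (T ∘ base) ⟩
      count (T ∘ base)                                      ≡⟨ count-combine n (T ∘ base) ⟩
      sumFin (λ i → count (λ a → T (base (vertex i a))))  ≡⟨ sumFin-cong (λ i → count-cong (cong T ∘ base-vertex i)) ⟩
      sumFin {n} (λ _ → count T)                            ≡⟨ sumFin-const n (count T) ⟩
      n * count T                                           ∎
      where open ≡-Reasoning

    -- An edge inside H_i is handled by the copy in H_i of the endpoint or landmark
    -- of T, or (root case) by a landmark in another copy; an edge (i , v)(j , v)
    -- between roots is distinguished by (i , c₀), at distance d_H(c₀ , v) from
    -- (i , v) and one more from (j , v).
    spread-generator : ∀ T c₀ → T c₀ ≡ true → Resolves T → IsLocalMetricGenerator P (spread T)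
    spread-generator T c₀ Tc₀ resolves p q e with edge-cases e
    ... | inj₁ (sameCopy , eH) =
      let (w , w∈ , D) = copyEdge (copyIndex p) eH in
      w , w∈ , subst₂ (Distinguishes P w) (vertex-η p) (trans (cong₂ vertex sameCopy refl) (vertex-η q)) D
      where
      copyEdge : ∀ i {a b} → a ~[ H ] b → ∃ λ w → w ∈ spread T × Distinguishes P w (vertex i a) (vertex i b)
      copyEdge i {a} {b} eH with resolves a b eH
      ... | inj₁ Ta                      = vertex i a , ∈spread Ta , endpointˡ (adj⇒≢ sH eH ∘ combine-injectiveʳ i a i b)
      ... | inj₂ (inj₁ Tb)               = vertex i b , ∈spread Tb , endpointʳ (adj⇒≢ sH eH ∘ combine-injectiveʳ i a i b)
      ... | inj₂ (inj₂ (inj₁ (c , Tc , D))) = vertex i c , ∈spread Tc , landmark-inside D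
      ... | inj₂ (inj₂ (inj₂ D))         =
        let (j , j≢i) = another i in
        vertex j c₀ , ∈spread Tc₀ , landmark-outside (j≢i ∘ trans (sym (copyIndex-vertex j c₀))) D
    ... | inj₂ (p-root , q-root , eG) =
      let (w , w∈ , D) = rootEdge eG in
      w , w∈ , subst₂ (Distinguishes P w) (sym (vertex-≡ refl p-root)) (sym (vertex-≡ refl q-root)) D
      where
      rootEdge : ∀ {i j} → i ~[ G ] j → ∃ λ w → w ∈ spread T × Distinguishes P w (vertex i v) (vertex j v)
      rootEdge {i} {j} eG with distH c₀ v
      ... | s , ds = vertex i c₀ , ∈spread Tc₀ ,
        distinguishes-by-dist (dist-copy i (dist-symH ds))
          (dist-symP (subst (Dist P (vertex i c₀) (vertex j v)) (+-comm s 1)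
            (dist-through-root i ds (dist₁ (root-edge eG) (adj⇒≢ sG eG ∘ combine-injectiveˡ i v j v))
                               (adj⇒≢ sG eG ∘ sym ∘ trans (sym (copyIndex-vertex j v))))))
          (1+n≢n ∘ sym)

    complement-generator : ∀ S c₀ → S c₀ ≡ false →
      (∀ a b → a ~[ H ] b → S a ≡ true → S b ≡ true → Distinguishes H v a b) →
      ∀ k → k ≤ count S → GeneratorWithin P (n * (n' ∸ k))
    complement-generator S c₀ Sc₀ inner k k≤ =
      spread (not ∘ S) , spread-generator (not ∘ S) c₀ (cong not Sc₀) resolves ,
      subst (_≤ n * (n' ∸ k)) (sym (∣spread∣ (not ∘ S))) (*-monoʳ-≤ n (count-not≤ S k k≤))
      where
      resolves : Resolves (not ∘ S)
      resolves a b e with S a in Sa | S b in Sb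
      ... | false | _     = inj₁ refl
      ... | true  | false = inj₂ (inj₁ refl)
      ... | true  | true  = inj₂ (inj₂ (inj₂ (inner a b e Sa Sb)))

    root-endpoint : ∀ {a b} → a ~[ H ] b → a ≡ v ⊎ b ≡ v → Distinguishes H v a b
    root-endpoint e (inj₁ refl) = WalksH.endpointˡ (adj⇒≢ sH e)
    root-endpoint e (inj₂ refl) = WalksH.endpointʳ (adj⇒≢ sH e)

    generator≤n[n'∸2] : ¬ Bipartite H → GeneratorWithin P (n * (n' ∸ 2))
    generator≤n[n'∸2] nb with vertex-outside H sH nb v v v (no-loop sH)
    ... | z , z≢v , _ with vertex-outside H sH nb v v z (no-loop sH)
    ...   | c₀ , c₀≢v , _ , c₀≢z =
      complement-generator (pair v z) c₀ (pair-∌ c₀≢v c₀≢z) inner 2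
        (count≥2 (pair v z) v z (pair-∋ˡ v z) (pair-∋ʳ v z) z≢v)
      where
      inner : ∀ a b → a ~[ H ] b → pair v z a ≡ true → pair v z b ≡ true → Distinguishes H v a b
      inner a b e a∈ b∈ with pair-∈ v z a∈ | pair-∈ v z b∈
      ... | inj₁ a≡v  | _         = root-endpoint e (inj₁ a≡v)
      ... | _         | inj₁ b≡v  = root-endpoint e (inj₂ b≡v)
      ... | inj₂ refl | inj₂ refl = ⊥-elim (no-loop sH e)

    generator≤n[n'∸3] : ∀ z z' → z ≢ v → z' ≢ v → z' ≢ z → (z ~[ H ] z' → Distinguishes H v z z') →
      ∀ c₀ → c₀ ≢ v → c₀ ≢ z → c₀ ≢ z' → GeneratorWithin P (n * (n' ∸ 3))
    generator≤n[n'∸3] z z' z≢v z'≢v z'≢z distinguished c₀ c₀≢v c₀≢z c₀≢z' =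
      complement-generator (triple v z z') c₀ (triple-∌ c₀≢v c₀≢z c₀≢z') inner 3
        (count-triple≥3 v z z' z≢v z'≢v z'≢z)
      where
      inner : ∀ a b → a ~[ H ] b → triple v z z' a ≡ true → triple v z z' b ≡ true → Distinguishes H v a b
      inner a b e a∈ b∈ with triple-∈ v z z' a∈ | triple-∈ v z z' b∈
      ... | inj₁ a≡v                | _                        = root-endpoint e (inj₁ a≡v)
      ... | _                       | inj₁ b≡v                 = root-endpoint e (inj₂ b≡v)
      ... | inj₂ (inj₁ refl)        | inj₂ (inj₁ refl)         = ⊥-elim (no-loop sH e)
      ... | inj₂ (inj₂ refl)        | inj₂ (inj₂ refl)         = ⊥-elim (no-loop sH e)
      ... | inj₂ (inj₁ refl)        | inj₂ (inj₂ refl)         = distinguished e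
      ... | inj₂ (inj₂ refl)        | inj₂ (inj₁ refl)         =
        WalksH.distinguishes-swap (distinguished (adj-symH e))

    -- (iv), non-edge at the root: if v ≁ y (y ≠ v), leave out v, y and a neighbour u
    -- of v; v distinguishes u and y, since u ~ v but y ≁ v.
    root-nonedge⇒generator : ¬ Bipartite H → ∀ y → y ≢ v → ¬ (v ~[ H ] y) → GeneratorWithin P (n * (n' ∸ 3))
    root-nonedge⇒generator nb y y≢v v≁y with cH v y
    ... | zero , w = ⊥-elim (y≢v (sym (WalksH.walk₀⇒≡ w)))
    ... | suc _ , cons {y = u} v~u _ =
      let (c₀ , c₀≢v , c₀≢y , c₀≢u) = vertex-outside H sH nb v y u v≁y in
      generator≤n[n'∸3] u y (adj⇒≢ sH v~u ∘ sym) y≢v (λ y≡u → v≁y (subst (v ~[ H ]_) (sym y≡u) v~u))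
        (λ _ → WalksH.private-neighbour (adj-symH v~u) y≢v (v≁y ∘ adj-symH))
        c₀ c₀≢v c₀≢u c₀≢y

    nonedge⇒generator : ¬ Bipartite H → ∀ x y → x ≢ y → Adj H x y ≡ false → GeneratorWithin P (n * (n' ∸ 3))
    nonedge⇒generator nb x y x≢y xy-false with x ≟ᶠ v | y ≟ᶠ v
    ... | yes refl | _        = root-nonedge⇒generator nb y (x≢y ∘ sym) (false⇒≁ H xy-false)
    ... | no x≢v   | yes refl =
      root-nonedge⇒generator nb x x≢v (false⇒≁ H (trans (IsSimple.sym sH v x) xy-false))
    ... | no x≢v   | no y≢v   =
      let (c₀ , c₀≢x , c₀≢y , c₀≢v) = vertex-outside H sH nb x y v (false⇒≁ H xy-false) in
      generator≤n[n'∸3] x y x≢v y≢v (x≢y ∘ sym) (⊥-elim ∘ false⇒≁ H xy-false) c₀ c₀≢v c₀≢x c₀≢y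

    -- (ii), backward: if {v , x} is a local metric basis of H, the singleton
    -- template {x} resolves H, giving a generator of size n.
    basis-through-root⇒generator : IsLocalMetricDim H 2 → (∃ λ B → IsLocalMetricBasis H B × v ∈ B)
      → GeneratorWithin P n
    basis-through-root⇒generator ((B₂ , gen₂ , ∣B₂∣≡2) , min₂) (B , (genB , dimB) , v∈B)
      with another-member (lookup B) (subst (2 ≤_) (∣W∣≡count B) (min₂ B genB)) v
    ... | x , x∈B , x≢v =
      spread (single x) , spread-generator (single x) x (single-self x) resolves ,
      ≤-reflexive (trans (∣spread∣ (single x)) (trans (cong (n *_) (count-single x)) (*-identityʳ n)))
      where
      ∣B∣≤2 : count (lookup B) ≤ 2
      ∣B∣≤2 = subst₂ _≤_ (∣W∣≡count B) ∣B₂∣≡2 (proj₂ dimB B₂ gen₂)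
      resolves : Resolves (single x)
      resolves a b e with genB a b e
      ... | w , w∈B , D with only-two (lookup B) ∣B∣≤2 (∈⇒lookup v∈B) x∈B x≢v (∈⇒lookup w∈B)
      ...   | inj₁ refl = inj₂ (inj₂ (inj₂ D))
      ...   | inj₂ refl = inj₂ (inj₂ (inj₁ (w , single-self w , D)))

proposition11 : (n n' : ℕ) → 2 ≤ n → (G : Graph n) → (H : Graph n') → (v : Fin n')
    → IsSimple G → Connected G → IsSimple H → Connected H → ¬ Bipartite H
    → (k : ℕ) → IsLocalMetricDim (RootedProduct G H v) k
    → (n ≤ k × k ≤ n * (n' ∸ 2))
    × (k ≡ n ⇔ (IsLocalMetricDim H 2 × ∃ λ W → IsLocalMetricBasis H W × v ∈ W))
    × (k ≡ n * (n' ∸ 2) ⇔ H ≅ Complete n')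
    × (¬ (H ≅ Complete n') → k ≤ n * (n' ∸ 3))
proposition11 n@(suc (suc _)) n' (s≤s (s≤s z≤n)) G H v sG cG sH cH nb k ((W₀ , gen₀ , ∣W₀∣≡k) , minimal) =
  (n≤k , k≤ (generator≤n[n'∸2] nb)) ,
  mk⇔ (size-n⇒basis-through-root nb zero W₀ gen₀ ∘ trans ∣W₀∣≡k)
      (λ (dim₂ , basis) → ≤-antisym (k≤ (basis-through-root⇒generator dim₂ basis)) n≤k) ,
  mk⇔ (λ k≡ → [ id , (λ nonedge → contradiction (subst (_≤ _) k≡ (k≤n[n'∸3] nonedge))
                                      (n[n'∸2]≰n[n'∸3] n n' (nonBipartite⇒order≥3 H sH nb v))) ]
                 (complete-or-nonedge H sH))
      (λ K → ≤-antisym (k≤ (generator≤n[n'∸2] nb))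
                        (subst (_ ≤_) ∣W₀∣≡k (complete⇒n[n'∸2]≤∣generator∣ K W₀ gen₀))) ,
  λ notComplete → [ ⊥-elim ∘ notComplete , k≤n[n'∸3] ] (complete-or-nonedge H sH)
  where
  open Landmarks G H v sG cG sH cH
  another : ∀ (i : Fin n) → ∃ λ j → j ≢ i
  another zero    = suc zero , λ ()
  another (suc _) = zero , λ ()
  open Templates another

  k≤ : ∀ {b} → GeneratorWithin P b → k ≤ b
  k≤ (W , gen , ∣W∣≤b) = ≤-trans (minimal W gen) ∣W∣≤b

  n≤k : n ≤ k
  n≤k = subst (n ≤_) ∣W₀∣≡k (n≤∣generator∣ nb W₀ gen₀)

  k≤n[n'∸3] : (∃₂ λ x y → x ≢ y × Adj H x y ≡ false) → k ≤ n * (n' ∸ 3)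
  k≤n[n'∸3] (x , y , x≢y , xy-false) = k≤ (nonedge⇒generator nb x y x≢y xy-false)
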